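{- For every integer $m\geq 3$ and every positive integer $n$, the cylinder $C(m,2n+1)=P_m\square C_{2n+1}$ is interval colorable, and $$w(C(m,2n+1))=\begin{cases}4,& \text{if } m \text{ is even},\\ 6,& \text{if } m \text{ is odd}.\end{cases}$$
   Context: All graphs are finite, undirected, without loops or multiple edges. An edge-coloring of a graph $G$ with colors $1,\ldots,t$ is an interval $t$-coloring if all $t$ colors are used, and the colors of the edges incident to each vertex are distinct and form an interval of consecutive integers. A graph is interval colorable if it has an interval $t$-coloring for some positive integer $t$; for such a graph, $w(G)$ is the least such $t$. $P_m$ is the path on $m$ vertices and $C_k$ the cycle on $k$ vertices. The Cartesian product $G\square H$ has vertex set $V(G)\times V(H)$, with $(u_1,v_1)(u_2,v_2)$ an edge iff either $u_1=u_2$ and $v_1v_2\in E(H)$, or $v_1=v_2$ and $u_1u_2\in E(G)$. -}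

module Defs where

open import Data.Nat using (ℕ; zero; suc; _+_; _*_; _≤_; _%_; NonZero)
open import Data.Fin using (Fin; toℕ)
open import Data.Product using (Σ; _×_; _,_; ∃; ∃-syntax)
open import Data.Sum using (_⊎_)
open import Relation.Binary.PropositionalEquality using (_≡_)

-- A graph: vertex set V and an adjacency relation Adj.
-- (The concrete graphs below are finite, with symmetric, irreflexive Adj.)
record Graph : Set₁ where
  field
    V   : Set
    Adj : V → V → Set
open Graph public

Path : ℕ → Graph
Path m = record
  { V   = Fin m
  ; Adj = λ i j → (suc (toℕ i) ≡ toℕ j) ⊎ (suc (toℕ j) ≡ toℕ i) }

-- Cycle C_k on vertices 0,…,k-1: i ~ j iff j ≡ i+1 (mod k) or i ≡ j+1 (mod k).
-- (Used for k ≥ 3, where this is the simple k-cycle.)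
Cycle : (k : ℕ) → .{{NonZero k}} → Graph
Cycle k = record
  { V   = Fin k
  ; Adj = λ i j → (suc (toℕ i) % k ≡ toℕ j) ⊎ (suc (toℕ j) % k ≡ toℕ i) }

_□_ : Graph → Graph → Graph
G □ H = record
  { V   = V G × V H
  ; Adj = λ { (u₁ , v₁) (u₂ , v₂) →
              ((u₁ ≡ u₂) × Adj H v₁ v₂) ⊎ ((v₁ ≡ v₂) × Adj G u₁ u₂) } }

-- An edge-colouring is a function c on ordered pairs of vertices, only
-- meaningful on edges, required to be symmetric there (so it colours the
-- undirected edge uv).  Interval t-colouring:
record IsIntervalColoring (G : Graph) (t : ℕ) (c : V G → V G → ℕ) : Set where
  field
    symmetric : ∀ u v → Adj G u v → c u v ≡ c v u
    inRange   : ∀ u v → Adj G u v → (1 ≤ c u v) × (c u v ≤ t)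
    allUsed   : ∀ k → 1 ≤ k → k ≤ t → ∃[ u ] ∃[ v ] (Adj G u v × c u v ≡ k)
    distinct  : ∀ v u w → Adj G v u → Adj G v w → c v u ≡ c v w → u ≡ w
    interval  : ∀ v u w k → Adj G v u → Adj G v w → c v u ≤ k → k ≤ c v w →
                ∃[ x ] (Adj G v x × c v x ≡ k)

HasIntervalColoring : Graph → ℕ → Set
HasIntervalColoring G t = Σ (V G → V G → ℕ) (IsIntervalColoring G t)

IntervalColorable : Graph → Set
IntervalColorable G = ∃[ t ] ((1 ≤ t) × HasIntervalColoring G t)

IsW : Graph → ℕ → Set
IsW G w = HasIntervalColoring G w × (∀ t → HasIntervalColoring G t → w ≤ t)

Cyl : (m k : ℕ) → .{{NonZero k}} → Graph
Cyl m k = Path m □ Cycle k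

module Submission where

-- Lower bounds, valid for interval colourings of arbitrary graphs: a vertex
-- with d distinct neighbours forces at least d colours, and the cylinder has
-- vertices of degree 4.  If every vertex has degree at least 3 and at most five
-- colours are used, colour 3 occurs at every vertex, so the colour-3 edges form
-- a perfect matching; for odd m this contradicts the odd number m(2n+1) of
-- vertices.
--
-- Upper bounds are explicit.  A pattern colours every edge according to the
-- class of its row (top, interior, bottom, with parity) and column (first,
-- interior with parity, last).  A local-to-global lemma reduces the interval
-- property to a local condition at the finitely many vertex classes, which is
-- checked by evaluation for a 4-colour pattern (m even) and a 6-colour one
-- (m odd).

open import Defs
open import Data.Nat using (ℕ; zero; suc; _+_; _*_; _∸_; _≤_; _<_; _%_; z≤n; s≤s; _≤?_; _<?_; _≟_; NonZero; _⊓_; _⊔_)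
open import Data.Nat.Properties
open import Data.Nat.DivMod using (%-distribˡ-*; m*n%n≡0; [m+n]%n≡m%n; [m+kn]%n≡m%n; m<n⇒m%n≡m; n%n≡0; %-congˡ; m%n<n)
open import Data.Fin as Fin using (Fin; toℕ; fromℕ<)
import Data.Fin.Properties as FinP
open import Data.Fin.Permutation using (Permutation; permutation)
open import Data.Bool using (Bool; true; false; not; T; T?)
import Data.Bool as Bool
open import Data.Product using (Σ; ∃-syntax; _×_; _,_; proj₁; proj₂)
open import Data.Sum using (_⊎_; inj₁; inj₂)
open import Data.Empty using (⊥-elim)
open import Data.Unit using (⊤; tt)
open import Function.Bundles using (_↔_; Inverse)
open import Function.Definitions using (Injective)
open import Relation.Nullary using (¬_; Dec; yes; no)
open import Relation.Nullary.Decidable using (map′; _×-dec_; _→-dec_; toWitness)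
open import Relation.Binary.PropositionalEquality
open import Algebra.Properties.CommutativeMonoid.Sum +-0-commutativeMonoid
  using (sum; sum-cong-≗; sum-permute; ∑-distrib-+)

-- d pairwise distinct natural numbers lying in the window [lo, lo + L)
-- number at most L: shifting by lo injects them into Fin L.
distinct-in-window : ∀ {d} lo L (f : Fin d → ℕ) → Injective _≡_ _≡_ f →
                     (∀ i → lo ≤ f i) → (∀ i → f i < lo + L) → d ≤ L
distinct-in-window {d} lo L f f-inj above below = FinP.injective⇒≤ {f = shifted} shifted-inj
  where
    offset< : ∀ i → f i ∸ lo < L
    offset< i = +-cancelˡ-< lo (f i ∸ lo) L
                  (subst (_< lo + L) (sym (m+[n∸m]≡n (above i))) (below i))
    shifted : Fin d → Fin L
    shifted i = fromℕ< (offset< i)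
    shifted-inj : Injective _≡_ _≡_ shifted
    shifted-inj {i} {j} e = f-inj (begin
      f i              ≡⟨ sym (m+[n∸m]≡n (above i)) ⟩
      lo + (f i ∸ lo)  ≡⟨ cong (lo +_) (FinP.fromℕ<-injective _ _ (offset< i) (offset< j) e) ⟩
      lo + (f j ∸ lo)  ≡⟨ m+[n∸m]≡n (above j) ⟩
      f j              ∎)
      where open ≡-Reasoning

-- A fixed-point-free involution on Fin N pairs up its elements, so N is even.
-- Each pair {x, f x} is counted exactly once by the indicator of x < f x, hence
-- N = Σ [x < f x] + Σ [f x < x], and the two sums agree since f is a permutation.
-- the indicator of a < b
less : ℕ → ℕ → ℕ
less a b with a <? b
... | yes _ = 1
... | no _  = 0

less-split : ∀ a b → a ≢ b → less a b + less b a ≡ 1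
less-split a b a≢b with a <? b | b <? a
... | yes a<b | yes b<a = ⊥-elim (<-asym a<b b<a)
... | yes _   | no _    = refl
... | no _    | yes _   = refl
... | no a≮b  | no b≮a  = ⊥-elim (a≢b (≤-antisym (≮⇒≥ b≮a) (≮⇒≥ a≮b)))

sum-ones : ∀ N → sum {N} (λ _ → 1) ≡ N
sum-ones zero    = refl
sum-ones (suc N) = cong suc (sum-ones N)

fin-involution-even : ∀ N (f : Fin N → Fin N) → (∀ x → f (f x) ≡ x) → (∀ x → f x ≢ x) →
                      Σ ℕ λ h → N ≡ h + h
fin-involution-even N f invol fixfree = sum ascent , (begin
  N                                      ≡⟨ sym (sum-ones N) ⟩
  sum {N} (λ _ → 1)                      ≡⟨ sum-cong-≗ pair-counted-once ⟩
  sum (λ x → ascent x + ascent (f x))    ≡⟨ ∑-distrib-+ ascent (λ x → ascent (f x)) ⟩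
  sum ascent + sum (λ x → ascent (f x))  ≡⟨ cong (sum ascent +_) (sym (sum-permute ascent π)) ⟩
  sum ascent + sum ascent                ∎)
  where
    open ≡-Reasoning
    ascent : Fin N → ℕ
    ascent x = less (toℕ x) (toℕ (f x))
    pair-counted-once : ∀ x → 1 ≡ ascent x + ascent (f x)
    pair-counted-once x = sym (begin
      ascent x + ascent (f x)
        ≡⟨ cong (λ y → ascent x + less (toℕ (f x)) (toℕ y)) (invol x) ⟩
      less (toℕ x) (toℕ (f x)) + less (toℕ (f x)) (toℕ x)
        ≡⟨ less-split _ _ (λ e → fixfree x (sym (FinP.toℕ-injective e))) ⟩
      1 ∎)
    π : Permutation N N
    π = permutation f f invol invol

involution-even : ∀ {A : Set} N → Fin N ↔ A →
                  (f : A → A) → (∀ x → f (f x) ≡ x) → (∀ x → f x ≢ x) → Σ ℕ λ h → N ≡ h + h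
involution-even N e f invol fixfree = fin-involution-even N g g-invol g-fixfree
  where
    open Inverse e
    g : Fin N → Fin N
    g x = from (f (to x))
    g-invol : ∀ x → g (g x) ≡ x
    g-invol x = trans (cong (λ y → from (f y)) (strictlyInverseˡ (f (to x))))
                      (trans (cong from (invol (to x))) (strictlyInverseʳ x))
    g-fixfree : ∀ x → g x ≢ x
    g-fixfree x gx≡x = fixfree (to x) (trans (sym (strictlyInverseˡ (f (to x)))) (cong to gx≡x))

odd*odd≢double : ∀ a b h → a % 2 ≡ 1 → b % 2 ≡ 1 → a * b ≢ h + h
odd*odd≢double a b h a-odd b-odd ab≡h+h = 1+n≢0 (begin
  1                          ≡⟨ cong₂ (λ x y → (x * y) % 2) (sym a-odd) (sym b-odd) ⟩
  ((a % 2) * (b % 2)) % 2    ≡⟨ sym (%-distribˡ-* a b 2) ⟩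
  (a * b) % 2                ≡⟨ cong (_% 2) (trans ab≡h+h h+h≡h*2) ⟩
  (h * 2) % 2                ≡⟨ m*n%n≡0 h 2 ⟩
  0                          ∎)
  where
    open ≡-Reasoning
    h+h≡h*2 : h + h ≡ h * 2
    h+h≡h*2 = trans (cong (h +_) (sym (+-identityʳ h))) (*-comm 2 h)

record Star (G : Graph) (v : V G) (d : ℕ) : Set where
  field
    leaf      : Fin d → V G
    leaf-inj  : Injective _≡_ _≡_ leaf
    leaf-adj  : ∀ i → Adj G v (leaf i)

module IntervalColouringFacts {G : Graph} {t : ℕ} {c : V G → V G → ℕ}
                              (ic : IsIntervalColoring G t c) where
  open IsIntervalColoring ic

  module _ {v : V G} {d : ℕ} (s : Star G v d) where
    open Star s

    star-colour : Fin d → ℕ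
    star-colour i = c v (leaf i)

    star-colour-inj : Injective _≡_ _≡_ star-colour
    star-colour-inj e = leaf-inj (distinct v _ _ (leaf-adj _) (leaf-adj _) e)

    star-colour-range : ∀ i → (1 ≤ star-colour i) × (star-colour i ≤ t)
    star-colour-range i = inRange v (leaf i) (leaf-adj i)

    star≤colours : d ≤ t
    star≤colours = distinct-in-window 1 t star-colour star-colour-inj
                     (λ i → proj₁ (star-colour-range i)) (λ i → s≤s (proj₂ (star-colour-range i)))

    -- A vertex of degree d sees every colour q with q ≤ d and t < q + d:
    -- neither can all d colours lie below q, nor all above q, and the colours
    -- at v form an interval.
    star-sees : ∀ q → 1 ≤ q → q ≤ d → t < q + d → ∃[ u ] (Adj G v u × c v u ≡ q)
    star-sees q 1≤q q≤d t<q+d =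
      let (i , cᵢ≤q) = some-below
          (j , q≤cⱼ) = some-above
      in interval v (leaf i) (leaf j) q (leaf-adj i) (leaf-adj j) cᵢ≤q q≤cⱼ
      where
        some-below : ∃[ i ] (star-colour i ≤ q)
        some-below with FinP.any? (λ i → star-colour i ≤? q)
        ... | yes found = found
        ... | no none = ⊥-elim (<⇒≱ t<q+d (begin
          q + d           ≤⟨ +-monoʳ-≤ q (distinct-in-window (suc q) (t ∸ q) star-colour star-colour-inj
                               (λ i → ≰⇒> (λ le → none (i , le)))
                               (λ i → s≤s (≤-trans (proj₂ (star-colour-range i)) (m≤n+m∸n t q)))) ⟩
          q + (t ∸ q)     ≡⟨ m+[n∸m]≡n (≤-trans q≤d star≤colours) ⟩
          t               ∎))
          where open ≤-Reasoning
        some-above : ∃[ j ] (q ≤ star-colour j)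
        some-above with FinP.any? (λ j → q ≤? star-colour j)
        ... | yes found = found
        ... | no none = ⊥-elim (1+n≰n (≤-trans (≤-reflexive 1+[q∸1]≡q) (≤-trans q≤d d≤q∸1)))
          where
            1+[q∸1]≡q : suc (q ∸ 1) ≡ q
            1+[q∸1]≡q = m+[n∸m]≡n 1≤q
            d≤q∸1 : d ≤ q ∸ 1
            d≤q∸1 = distinct-in-window 1 (q ∸ 1) star-colour star-colour-inj
                      (λ j → proj₁ (star-colour-range j))
                      (λ j → subst (star-colour j <_) (sym 1+[q∸1]≡q) (≰⇒> (λ le → none (j , le))))

-- If every vertex of G has three distinct neighbours and G has an interval
-- colouring with at most five colours, then colour 3 appears at every vertex,
-- the edges of colour 3 form a perfect matching, and G has an even number of
-- vertices.
module ColourThreeMatching {G : Graph}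
         (adj-sym : ∀ {u v} → Adj G u v → Adj G v u) (adj-irr : ∀ {v} → ¬ Adj G v v)
         (three : ∀ v → Star G v 3)
         {t : ℕ} {c : V G → V G → ℕ} (ic : IsIntervalColoring G t c) (t≤5 : t ≤ 5) where
  open IsIntervalColoring ic
  open IntervalColouringFacts ic

  sees-3 : ∀ v → ∃[ u ] (Adj G v u × c v u ≡ 3)
  sees-3 v = star-sees (three v) 3 (s≤s z≤n) ≤-refl (s≤s t≤5)

  partner : V G → V G
  partner v = proj₁ (sees-3 v)

  partner-adj : ∀ v → Adj G v (partner v)
  partner-adj v = proj₁ (proj₂ (sees-3 v))

  partner-colour : ∀ v → c v (partner v) ≡ 3
  partner-colour v = proj₂ (proj₂ (sees-3 v))

  -- both v and partner (partner v) are joined to partner v by a colour-3 edge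
  partner-involutive : ∀ v → partner (partner v) ≡ v
  partner-involutive v = distinct u (partner u) v (partner-adj u) (adj-sym (partner-adj v)) (begin
    c u (partner u)  ≡⟨ partner-colour u ⟩
    3                ≡⟨ sym (partner-colour v) ⟩
    c v u            ≡⟨ symmetric v u (partner-adj v) ⟩
    c u v            ∎)
    where
      open ≡-Reasoning
      u : V G
      u = partner v

  partner-fixfree : ∀ v → partner v ≢ v
  partner-fixfree v e = adj-irr (subst (Adj G v) e (partner-adj v))

  even-order : ∀ N → Fin N ↔ V G → Σ ℕ λ h → N ≡ h + h
  even-order N e = involution-even N e partner partner-involutive partner-fixfree

odd-order⇒six-colours : ∀ {G : Graph} →
  (∀ {u v} → Adj G u v → Adj G v u) → (∀ {v} → ¬ Adj G v v) → (∀ v → Star G v 3) →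
  ∀ N → Fin N ↔ V G → (∀ h → N ≢ h + h) →
  ∀ {t} {c : V G → V G → ℕ} → IsIntervalColoring G t c → 6 ≤ t
odd-order⇒six-colours adj-sym adj-irr three N e N-odd {t} ic with 6 ≤? t
... | yes 6≤t = 6≤t
... | no  6≰t = ⊥-elim (N-odd (proj₁ N-even) (proj₂ N-even))
  where
    open ColourThreeMatching adj-sym adj-irr three ic (≤-pred (≰⇒> 6≰t))
    N-even : Σ ℕ λ h → N ≡ h + h
    N-even = even-order N e

record Enumeration (A : Set) : Set where
  field
    size       : ℕ
    elem       : Fin size → A
    index      : A → Fin size
    elem-index : ∀ x → elem (index x) ≡ x

module _ {A : Set} (E : Enumeration A) where
  open Enumeration E

  all? : {Q : A → Set} → (∀ x → Dec (Q x)) → Dec (∀ x → Q x)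
  all? {Q} Q? = map′ (λ h x → subst Q (elem-index x) (h (index x))) (λ h i → h (elem i))
                     (FinP.all? (λ i → Q? (elem i)))

  any? : {Q : A → Set} → (∀ x → Dec (Q x)) → Dec (Σ A Q)
  any? {Q} Q? = map′ (λ (i , q) → elem i , q) (λ (x , q) → index x , subst Q (sym (elem-index x)) q)
                     (FinP.any? (λ i → Q? (elem i)))

  equal? : (x y : A) → Dec (x ≡ y)
  equal? x y = map′ (λ e → trans (sym (elem-index x)) (trans (cong elem e) (elem-index y))) (cong index)
                (index x FinP.≟ index y)

-- The directions from a vertex (i, j) of the cylinder: up to row i-1, down
-- to row i+1, left to column j-1 and right to column j+1 (modulo k).
data Dir : Set where
  up down left right : Dir

dirAt : Fin 4 → Dir
dirAt Fin.zero                            = up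
dirAt (Fin.suc Fin.zero)                  = down
dirAt (Fin.suc (Fin.suc Fin.zero))        = left
dirAt (Fin.suc (Fin.suc (Fin.suc _)))     = right

dirIndex : Dir → Fin 4
dirIndex up    = Fin.zero
dirIndex down  = Fin.suc Fin.zero
dirIndex left  = Fin.suc (Fin.suc Fin.zero)
dirIndex right = Fin.suc (Fin.suc (Fin.suc Fin.zero))

dirs : Enumeration Dir
dirs = record
  { size = 4 ; elem = dirAt ; index = dirIndex
  ; elem-index = λ { up → refl ; down → refl ; left → refl ; right → refl } }

dirIndex-dirAt : ∀ i → dirIndex (dirAt i) ≡ i
dirIndex-dirAt Fin.zero                                = refl
dirIndex-dirAt (Fin.suc Fin.zero)                      = refl
dirIndex-dirAt (Fin.suc (Fin.suc Fin.zero))            = refl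
dirIndex-dirAt (Fin.suc (Fin.suc (Fin.suc Fin.zero)))  = refl

-- Rows of P_m □ C_k fall into classes: the top row 0, and interior rows and the
-- bottom row m-1, both recorded together with the parity of their index.
data RowClass : Set where
  top      : RowClass
  interior : Bool → RowClass
  bottom   : Bool → RowClass

rowClasses : Enumeration RowClass
rowClasses = record { size = 5 ; elem = elem ; index = index ; elem-index = elem-index }
  where
    elem : Fin 5 → RowClass
    elem Fin.zero                                     = top
    elem (Fin.suc Fin.zero)                           = interior true
    elem (Fin.suc (Fin.suc Fin.zero))                 = interior false
    elem (Fin.suc (Fin.suc (Fin.suc Fin.zero)))       = bottom true
    elem (Fin.suc (Fin.suc (Fin.suc (Fin.suc _))))    = bottom false
    index : RowClass → Fin 5
    index top              = Fin.zero
    index (interior true)  = Fin.suc Fin.zero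
    index (interior false) = Fin.suc (Fin.suc Fin.zero)
    index (bottom true)    = Fin.suc (Fin.suc (Fin.suc Fin.zero))
    index (bottom false)   = Fin.suc (Fin.suc (Fin.suc (Fin.suc Fin.zero)))
    elem-index : ∀ r → elem (index r) ≡ r
    elem-index top              = refl
    elem-index (interior true)  = refl
    elem-index (interior false) = refl
    elem-index (bottom true)    = refl
    elem-index (bottom false)   = refl

-- Columns: column 0, interior columns with the parity of their index, and the
-- last column k-1.
data ColClass : Set where
  first : ColClass
  inner : Bool → ColClass
  last  : ColClass

colClasses : Enumeration ColClass
colClasses = record { size = 4 ; elem = elem ; index = index ; elem-index = elem-index }
  where
    elem : Fin 4 → ColClass
    elem Fin.zero                                = first
    elem (Fin.suc Fin.zero)                      = inner true
    elem (Fin.suc (Fin.suc Fin.zero))            = inner false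
    elem (Fin.suc (Fin.suc (Fin.suc _)))         = last
    index : ColClass → Fin 4
    index first         = Fin.zero
    index (inner true)  = Fin.suc Fin.zero
    index (inner false) = Fin.suc (Fin.suc Fin.zero)
    index last          = Fin.suc (Fin.suc (Fin.suc Fin.zero))
    elem-index : ∀ c → elem (index c) ≡ c
    elem-index first         = refl
    elem-index (inner true)  = refl
    elem-index (inner false) = refl
    elem-index last          = refl

-- Horizontal edges: the seam edge between columns k-1 and 0, and the edges
-- between columns j and j+1, recorded with the parity of j.
data EdgeType : Set where
  seam : EdgeType
  step : Bool → EdgeType

-- the horizontal edges leaving a vertex of the given column class to the right
-- and to the left; `leftEdge last` is an edge from an odd column, as k is odd
rightEdge : ColClass → EdgeType
rightEdge first     = step true
rightEdge (inner p) = step p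
rightEdge last      = seam

leftEdge : ColClass → EdgeType
leftEdge first     = seam
leftEdge (inner p) = step (not p)
leftEdge last      = step false

present : RowClass → Dir → Bool
present r          left  = true
present r          right = true
present top        up    = false
present _          up    = true
present (bottom _) down  = false
present _          down  = true

-- parity of the row above and of the row itself (the vertical edge down from
-- row i is recorded by the parity of i); the value for the absent up-edge of
-- the top row is irrelevant
abovePar : RowClass → Bool
abovePar top          = true
abovePar (interior p) = not p
abovePar (bottom p)   = not p

rowPar : RowClass → Bool
rowPar top          = true
rowPar (interior p) = p
rowPar (bottom p)   = p

-- A colouring pattern: vertical edges (i,j)(i+1,j) are coloured by the parity
-- of i and the class of column j, horizontal edges by the class of their row
-- and their edge type.
record Pattern : Set where
  field
    vertical   : Bool → ColClass → ℕ
    horizontal : RowClass → EdgeType → ℕ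
open Pattern

dirColour : Pattern → RowClass → ColClass → Dir → ℕ
dirColour P r c up    = vertical P (abovePar r) c
dirColour P r c down  = vertical P (rowPar r) c
dirColour P r c left  = horizontal P r (leftEdge c)
dirColour P r c right = horizontal P r (rightEdge c)

Local : ℕ → (Dir → Bool) → (Dir → ℕ) → Set
Local t pres col =
    (∀ d → T (pres d) → (1 ≤ col d) × (col d ≤ t))
  × (∀ d d' → T (pres d) → T (pres d') → col d ≡ col d' → d ≡ d')
  × (∀ d d' → T (pres d) → T (pres d') → (x : Fin (suc t)) → col d ≤ toℕ x → toℕ x ≤ col d' →
       Σ Dir λ d'' → T (pres d'') × (col d'' ≡ toℕ x))

local? : ∀ t pres col → Dec (Local t pres col)
local? t pres col =
  all? dirs (λ d → T? (pres d) →-dec ((1 ≤? col d) ×-dec (col d ≤? t)))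
  ×-dec all? dirs (λ d → all? dirs λ d' → T? (pres d) →-dec (T? (pres d') →-dec
          ((col d ≟ col d') →-dec (equal? dirs d d'))))
  ×-dec all? dirs (λ d → all? dirs λ d' → T? (pres d) →-dec (T? (pres d') →-dec
          FinP.all? λ x → (col d ≤? toℕ x) →-dec ((toℕ x ≤? col d') →-dec
            any? dirs λ d'' → T? (pres d'') ×-dec (col d'' ≟ toℕ x))))

-- the vertex classes that occur when the bottom row has parity b
Occurs : Bool → RowClass → Set
Occurs b (bottom p) = p ≡ b
Occurs b _          = ⊤

occurs? : ∀ b r → Dec (Occurs b r)
occurs? b top          = yes tt
occurs? b (interior _) = yes tt
occurs? b (bottom p)   = p Bool.≟ b

Valid : Pattern → ℕ → Bool → Set
Valid P t b = ∀ r c → Occurs b r → Local t (present r) (dirColour P r c)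

valid? : ∀ P t b → Dec (Valid P t b)
valid? P t b = all? rowClasses λ r → all? colClasses λ c →
               occurs? b r →-dec local? t (present r) (dirColour P r c)

evenPattern : Pattern
evenPattern = record { vertical = vert ; horizontal = λ _ → horiz }
  where
    vert : Bool → ColClass → ℕ
    vert true  first     = 2
    vert true  (inner _) = 3
    vert true  last      = 1
    vert false _         = 4
    horiz : EdgeType → ℕ
    horiz seam         = 3
    horiz (step true)  = 1
    horiz (step false) = 2

oddPattern : Pattern
oddPattern = record { vertical = vert ; horizontal = horiz }
  where
    vert : Bool → ColClass → ℕ
    vert true  first     = 1
    vert true  (inner _) = 2
    vert true  last      = 3
    vert false first     = 2
    vert false (inner _) = 4
    vert false last      = 6
    horiz : RowClass → EdgeType → ℕ
    horiz top seam         = 2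
    horiz top (step true)  = 3
    horiz top (step false) = 1
    horiz _   seam         = 4
    horiz _   (step true)  = 3
    horiz _   (step false) = 5

evenPattern-valid : Valid evenPattern 4 false
evenPattern-valid = toWitness {a? = valid? evenPattern 4 false} tt

oddPattern-valid : Valid oddPattern 6 true
oddPattern-valid = toWitness {a? = valid? oddPattern 6 true} tt

-- Four vertex classes that occur in every cylinder with at least three rows,
-- at the vertices (0,0), (1,0), (1,1) and (1,k-1).
data Sample : Set where
  at00 at10 at11 at1last : Sample

sampleRow : Sample → RowClass
sampleRow at00 = top
sampleRow _    = interior false

sampleCol : Sample → ColClass
sampleCol at00    = first
sampleCol at10    = first
sampleCol at11    = inner false
sampleCol at1last = last

Uses : Pattern → ℕ → Set
Uses P t = ∀ q → 1 ≤ q → q ≤ t →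
  Σ Sample λ s → Σ Dir λ d → T (present (sampleRow s) d) × (dirColour P (sampleRow s) (sampleCol s) d ≡ q)

evenPattern-uses : Uses evenPattern 4
evenPattern-uses 1 _ _ = at00 , right , tt , refl
evenPattern-uses 2 _ _ = at00 , down  , tt , refl
evenPattern-uses 3 _ _ = at00 , left  , tt , refl
evenPattern-uses 4 _ _ = at10 , down  , tt , refl
evenPattern-uses 0 () _
evenPattern-uses (suc (suc (suc (suc (suc _))))) _ (s≤s (s≤s (s≤s (s≤s ()))))

oddPattern-uses : Uses oddPattern 6
oddPattern-uses 1 _ _ = at00    , down  , tt , refl
oddPattern-uses 2 _ _ = at00    , left  , tt , refl
oddPattern-uses 3 _ _ = at00    , right , tt , refl
oddPattern-uses 4 _ _ = at10    , left  , tt , refl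
oddPattern-uses 5 _ _ = at11    , right , tt , refl
oddPattern-uses 6 _ _ = at1last , down  , tt , refl
oddPattern-uses 0 () _
oddPattern-uses (suc (suc (suc (suc (suc (suc (suc _))))))) _ (s≤s (s≤s (s≤s (s≤s (s≤s (s≤s ()))))))

isEven : ℕ → Bool
isEven zero          = true
isEven (suc zero)    = false
isEven (suc (suc x)) = isEven x

isEven-pred : ∀ x → isEven x ≡ not (isEven (suc x))
isEven-pred zero          = refl
isEven-pred (suc zero)    = refl
isEven-pred (suc (suc x)) = isEven-pred x

isEven-double : ∀ n → isEven (2 * n) ≡ true
isEven-double zero    = refl
isEven-double (suc n) = trans (cong isEven (+-suc (suc n) (n + 0))) (isEven-double n)

%2-cases : ∀ x → (x % 2 ≡ 0) ⊎ (x % 2 ≡ 1)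
%2-cases x with x % 2 | m%n<n x 2
... | 0           | _              = inj₁ refl
... | 1           | _              = inj₂ refl
... | suc (suc _) | s≤s (s≤s ())

%2-step : ∀ x → suc (suc x) % 2 ≡ x % 2
%2-step x = trans (cong (_% 2) (+-comm 2 x)) ([m+n]%n≡m%n x 2)

isEven-even : ∀ x → x % 2 ≡ 0 → isEven x ≡ true
isEven-even zero          _ = refl
isEven-even (suc zero)    ()
isEven-even (suc (suc x)) e = isEven-even x (trans (sym (%2-step x)) e)

isEven-odd : ∀ x → x % 2 ≡ 1 → isEven x ≡ false
isEven-odd zero          ()
isEven-odd (suc zero)    _ = refl
isEven-odd (suc (suc x)) e = isEven-odd x (trans (sym (%2-step x)) e)

isEven-∸1 : ∀ x → 1 ≤ x → isEven (x ∸ 1) ≡ not (isEven x)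
isEven-∸1 (suc x) _ = isEven-pred x

verticalDir : RowClass → Dir
verticalDir top = down
verticalDir _   = up

sideDirs : RowClass → Fin 3 → Dir
sideDirs r Fin.zero                 = left
sideDirs r (Fin.suc Fin.zero)       = right
sideDirs r (Fin.suc (Fin.suc _))    = verticalDir r

sideIndex : Dir → Fin 3
sideIndex left  = Fin.zero
sideIndex right = Fin.suc Fin.zero
sideIndex _     = Fin.suc (Fin.suc Fin.zero)

sideIndex-sideDirs : ∀ r i → sideIndex (sideDirs r i) ≡ i
sideIndex-sideDirs r            Fin.zero                     = refl
sideIndex-sideDirs r            (Fin.suc Fin.zero)           = refl
sideIndex-sideDirs top          (Fin.suc (Fin.suc Fin.zero)) = refl
sideIndex-sideDirs (interior _) (Fin.suc (Fin.suc Fin.zero)) = refl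
sideIndex-sideDirs (bottom _)   (Fin.suc (Fin.suc Fin.zero)) = refl

sideDirs-inj : ∀ r → Injective _≡_ _≡_ (sideDirs r)
sideDirs-inj r {i} {j} e = begin
  i                         ≡⟨ sym (sideIndex-sideDirs r i) ⟩
  sideIndex (sideDirs r i)  ≡⟨ cong sideIndex e ⟩
  sideIndex (sideDirs r j)  ≡⟨ sideIndex-sideDirs r j ⟩
  j                         ∎
  where open ≡-Reasoning

sideDirs-present : ∀ r i → T (present r (sideDirs r i))
sideDirs-present r            Fin.zero              = tt
sideDirs-present r            (Fin.suc Fin.zero)    = tt
sideDirs-present top          (Fin.suc (Fin.suc _)) = tt
sideDirs-present (interior _) (Fin.suc (Fin.suc _)) = tt
sideDirs-present (bottom _)   (Fin.suc (Fin.suc _)) = tt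

module CylinderGeometry (m k : ℕ) {{_ : NonZero k}} (2≤m : 2 ≤ m) (3≤k : 3 ≤ k) where

  G : Graph
  G = Cyl m k

  rowClass : ℕ → RowClass
  rowClass zero = top
  rowClass (suc a) with suc (suc a) <? m
  ... | yes _ = interior (isEven (suc a))
  ... | no _  = bottom (isEven (suc a))

  colClass : ℕ → ColClass
  colClass zero = first
  colClass (suc b) with suc (suc b) ≟ k
  ... | yes _ = last
  ... | no _  = inner (isEven (suc b))

  presentAt : V G → Dir → Bool
  presentAt (i , _) = present (rowClass (toℕ i))

  Present : V G → Dir → Set
  Present v d = T (presentAt v d)

  Nb : V G → Dir → V G → Set
  Nb (i , j) up    (i' , j') = (j ≡ j') × (suc (toℕ i') ≡ toℕ i)
  Nb (i , j) down  (i' , j') = (j ≡ j') × (suc (toℕ i) ≡ toℕ i')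
  Nb (i , j) right (i' , j') = (i ≡ i') × (suc (toℕ j) % k ≡ toℕ j')
  Nb (i , j) left  (i' , j') = (i ≡ i') × (suc (toℕ j') % k ≡ toℕ j)

  classify : ∀ v u → Adj G v u → Σ Dir λ d → Nb v d u
  classify v u (inj₁ (e , inj₁ x)) = right , e , x
  classify v u (inj₁ (e , inj₂ x)) = left , e , x
  classify v u (inj₂ (e , inj₁ x)) = down , e , x
  classify v u (inj₂ (e , inj₂ x)) = up , e , x

  nb-adj : ∀ v d u → Nb v d u → Adj G v u
  nb-adj v up    u (e , x) = inj₂ (e , inj₂ x)
  nb-adj v down  u (e , x) = inj₂ (e , inj₁ x)
  nb-adj v right u (e , x) = inj₁ (e , inj₁ x)
  nb-adj v left  u (e , x) = inj₁ (e , inj₂ x)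

  adj-sym : ∀ {v u} → Adj G v u → Adj G u v
  adj-sym (inj₁ (e , inj₁ x)) = inj₁ (sym e , inj₂ x)
  adj-sym (inj₁ (e , inj₂ x)) = inj₁ (sym e , inj₁ x)
  adj-sym (inj₂ (e , inj₁ x)) = inj₂ (sym e , inj₂ x)
  adj-sym (inj₂ (e , inj₂ x)) = inj₂ (sym e , inj₁ x)

  1≢k : 1 ≢ k
  1≢k e = <⇒≱ (≤-trans (s≤s (s≤s z≤n)) 3≤k) (≤-reflexive (sym e))

  2≢k : 2 ≢ k
  2≢k e = <⇒≱ 3≤k (≤-reflexive (sym e))

  2+n≢n : ∀ {a} → suc (suc a) ≢ a
  2+n≢n {a} e = <⇒≢ (m<n+m a {2} (s≤s z≤n)) (sym e)

  succ-mod : ∀ b → b < k → (suc b < k × suc b % k ≡ suc b) ⊎ (suc b ≡ k × suc b % k ≡ 0)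
  succ-mod b b<k with suc b <? k
  ... | yes b+1<k = inj₁ (b+1<k , m<n⇒m%n≡m b+1<k)
  ... | no  b+1≮k = inj₂ (b+1≡k , trans (%-congˡ b+1≡k) (n%n≡0 k))
    where
      b+1≡k : suc b ≡ k
      b+1≡k = ≤-antisym b<k (≮⇒≥ b+1≮k)

  succ-mod-inj : ∀ x y → x < k → y < k → suc x % k ≡ suc y % k → x ≡ y
  succ-mod-inj x y x<k y<k e with succ-mod x x<k | succ-mod y y<k
  ... | inj₁ (_ , p) | inj₁ (_ , q) = suc-injective (trans (sym p) (trans e q))
  ... | inj₁ (_ , p) | inj₂ (_ , q) = ⊥-elim (1+n≢0 (trans (sym p) (trans e q)))
  ... | inj₂ (_ , p) | inj₁ (_ , q) = ⊥-elim (1+n≢0 (trans (sym q) (trans (sym e) p)))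
  ... | inj₂ (p , _) | inj₂ (q , _) = suc-injective (trans p (sym q))

  succ-mod-fixfree : ∀ b → b < k → suc b % k ≢ b
  succ-mod-fixfree b b<k e with succ-mod b b<k
  ... | inj₁ (_ , p) = 1+n≢n (trans (sym p) e)
  ... | inj₂ (p , q) = 1≢k (trans (cong suc (sym (trans (sym e) q))) p)

  succ-mod-2cycle : ∀ b b' → b < k → suc b % k ≡ b' → suc b' % k ≢ b
  succ-mod-2cycle b b' b<k x y with succ-mod b b<k
  succ-mod-2cycle b b' b<k x y | inj₁ (b+1<k , p) with trans (sym p) x
  ... | refl with succ-mod (suc b) b+1<k
  ...   | inj₁ (_ , q) = 2+n≢n (trans (sym q) y)
  ...   | inj₂ (q , r) = 2≢k (trans (cong (λ z → suc (suc z)) (sym (trans (sym y) r))) q)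
  succ-mod-2cycle b b' b<k x y | inj₂ (p , q) with trans (sym q) x
  ... | refl = 2≢k (trans (cong suc (trans (sym (m<n⇒m%n≡m (≤-trans (s≤s (s≤s z≤n)) 3≤k))) y)) p)

  nb-unique : ∀ v d u w → Nb v d u → Nb v d w → u ≡ w
  nb-unique (i , j) up (i' , .j) (i'' , .j) (refl , x) (refl , y) =
    cong (_, j) (FinP.toℕ-injective (suc-injective (trans x (sym y))))
  nb-unique (i , j) down (i' , .j) (i'' , .j) (refl , x) (refl , y) =
    cong (_, j) (FinP.toℕ-injective (trans (sym x) y))
  nb-unique (i , j) right (.i , j') (.i , j'') (refl , x) (refl , y) =
    cong (i ,_) (FinP.toℕ-injective (trans (sym x) y))
  nb-unique (i , j) left (.i , j') (.i , j'') (refl , x) (refl , y) =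
    cong (i ,_) (FinP.toℕ-injective (succ-mod-inj _ _ (FinP.toℕ<n j') (FinP.toℕ<n j'') (trans x (sym y))))

  -- a neighbour lies in only one direction (this is where k ≥ 3 is needed)
  nb-dir-unique : ∀ v d d' u → Nb v d u → Nb v d' u → d ≡ d'
  nb-dir-unique v up    up    u _ _ = refl
  nb-dir-unique v down  down  u _ _ = refl
  nb-dir-unique v left  left  u _ _ = refl
  nb-dir-unique v right right u _ _ = refl
  nb-dir-unique (i , j) up    down  (i' , .j) (refl , x) (_ , y) = ⊥-elim (2+n≢n (trans (cong suc y) x))
  nb-dir-unique (i , j) down  up    (i' , .j) (refl , x) (_ , y) = ⊥-elim (2+n≢n (trans (cong suc x) y))
  nb-dir-unique (i , j) up    left  (.i , .j) (refl , x) (refl , _) = ⊥-elim (1+n≢n x)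
  nb-dir-unique (i , j) up    right (.i , .j) (refl , x) (refl , _) = ⊥-elim (1+n≢n x)
  nb-dir-unique (i , j) down  left  (.i , .j) (refl , x) (refl , _) = ⊥-elim (1+n≢n x)
  nb-dir-unique (i , j) down  right (.i , .j) (refl , x) (refl , _) = ⊥-elim (1+n≢n x)
  nb-dir-unique (i , j) left  up    (.i , .j) (refl , _) (refl , y) = ⊥-elim (1+n≢n y)
  nb-dir-unique (i , j) right up    (.i , .j) (refl , _) (refl , y) = ⊥-elim (1+n≢n y)
  nb-dir-unique (i , j) left  down  (.i , .j) (refl , _) (refl , y) = ⊥-elim (1+n≢n y)
  nb-dir-unique (i , j) right down  (.i , .j) (refl , _) (refl , y) = ⊥-elim (1+n≢n y)
  nb-dir-unique (i , j) left  right (.i , j') (refl , x) (_ , y) = ⊥-elim (succ-mod-2cycle _ _ (FinP.toℕ<n j) y x)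
  nb-dir-unique (i , j) right left  (.i , j') (refl , x) (_ , y) = ⊥-elim (succ-mod-2cycle _ _ (FinP.toℕ<n j) x y)

  adj-irr : ∀ {v} → ¬ Adj G v v
  adj-irr {v} a with classify v v a
  adj-irr {i , j} a | up    , (_ , x) = 1+n≢n x
  adj-irr {i , j} a | down  , (_ , x) = 1+n≢n x
  adj-irr {i , j} a | right , (_ , x) = succ-mod-fixfree _ (FinP.toℕ<n j) x
  adj-irr {i , j} a | left  , (_ , x) = succ-mod-fixfree _ (FinP.toℕ<n j) x

  present-up⁻ : ∀ a → T (present (rowClass a) up) → Σ ℕ λ a' → suc a' ≡ a
  present-up⁻ zero    ()
  present-up⁻ (suc a) _ = a , refl

  present-down⁻ : ∀ a → T (present (rowClass a) down) → suc a < m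
  present-down⁻ zero    _ = 2≤m
  present-down⁻ (suc a) p with suc (suc a) <? m
  ... | yes a+2≤m = a+2≤m

  present-up : ∀ a → T (present (rowClass (suc a)) up)
  present-up a with suc (suc a) <? m
  ... | yes _ = tt
  ... | no _  = tt

  present-down : ∀ a → suc a < m → T (present (rowClass a) down)
  present-down zero    _ = tt
  present-down (suc a) a+2≤m with suc (suc a) <? m
  ... | yes _     = tt
  ... | no a+2≰m  = ⊥-elim (a+2≰m a+2≤m)

  pred-mod : ∀ b → b < k → Σ ℕ λ b' → b' < k × suc b' % k ≡ b
  pred-mod zero    _     = k ∸ 1 , ≤-reflexive k∸1+1≡k , trans (%-congˡ k∸1+1≡k) (n%n≡0 k)
    where
      k∸1+1≡k : suc (k ∸ 1) ≡ k
      k∸1+1≡k = m+[n∸m]≡n (≤-trans (s≤s z≤n) 3≤k)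
  pred-mod (suc b) b+1<k = b , <-trans (n<1+n b) b+1<k , m<n⇒m%n≡m b+1<k

  nb-present : ∀ v d u → Nb v d u → Present v d
  nb-present (i , j) up    (i' , j') (_ , x) = subst (λ a → T (present (rowClass a) up)) x (present-up (toℕ i'))
  nb-present (i , j) down  (i' , j') (_ , x) = present-down (toℕ i) (subst (_< m) (sym x) (FinP.toℕ<n i'))
  nb-present (i , j) left  u         _       = tt
  nb-present (i , j) right u         _       = tt

  neighbour : ∀ v d → Present v d → Σ (V G) (Nb v d)
  neighbour (i , j) up p with present-up⁻ (toℕ i) p
  ... | a , a+1≡i = (fromℕ< a<m , j) , refl , trans (cong suc (FinP.toℕ-fromℕ< a<m)) a+1≡i
    where
      a<m : a < m
      a<m = <⇒≤ (subst (_< m) (sym a+1≡i) (FinP.toℕ<n i))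
  neighbour (i , j) down p = (fromℕ< i+1<m , j) , refl , sym (FinP.toℕ-fromℕ< i+1<m)
    where
      i+1<m : suc (toℕ i) < m
      i+1<m = present-down⁻ (toℕ i) p
  neighbour (i , j) right _ = (i , fromℕ< (m%n<n (suc (toℕ j)) k)) , refl , sym (FinP.toℕ-fromℕ< _)
  neighbour (i , j) left  _ with pred-mod (toℕ j) (FinP.toℕ<n j)
  ... | b , b<k , e = (i , fromℕ< b<k) , refl , trans (cong (λ z → suc z % k) (FinP.toℕ-fromℕ< b<k)) e

  dirStar : ∀ {v d} (ds : Fin d → Dir) → Injective _≡_ _≡_ ds → (∀ i → Present v (ds i)) → Star G v d
  dirStar {v} ds ds-inj p = record
    { leaf     = λ i → proj₁ (nb i)
    ; leaf-inj = λ {i} {j} e → ds-inj (nb-dir-unique v (ds i) (ds j) (proj₁ (nb j))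
                                        (subst (Nb v (ds i)) e (proj₂ (nb i))) (proj₂ (nb j)))
    ; leaf-adj = λ i → nb-adj v (ds i) _ (proj₂ (nb i)) }
    where
      nb : ∀ i → Σ (V G) (Nb v (ds i))
      nb i = neighbour v (ds i) (p i)

  star3 : ∀ v → Star G v 3
  star3 (i , j) = dirStar (sideDirs r) (sideDirs-inj r) (sideDirs-present r)
    where
      r : RowClass
      r = rowClass (toℕ i)

  star4 : ∀ v → (∀ d → Present v d) → Star G v 4
  star4 v all-present = dirStar dirAt dirAt-inj (λ i → all-present (dirAt i))
    where
      dirAt-inj : Injective _≡_ _≡_ dirAt
      dirAt-inj {i} {j} e = trans (sym (dirIndex-dirAt i)) (trans (cong dirIndex e) (dirIndex-dirAt j))

  local-to-global : ∀ {t} (c : V G → V G → ℕ) (col : V G → Dir → ℕ) →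
    (∀ u v → c u v ≡ c v u) →
    (∀ v d u → Nb v d u → c v u ≡ col v d) →
    (∀ v → Local t (presentAt v) (col v)) →
    (∀ q → 1 ≤ q → q ≤ t → Σ (V G) λ v → Σ Dir λ d → Present v d × (col v d ≡ q)) →
    IsIntervalColoring G t c
  local-to-global {t} c col c-sym c-col local used = record
    { symmetric = λ u v _ → c-sym u v
    ; inRange   = in-range
    ; allUsed   = all-used
    ; distinct  = distinct
    ; interval  = interval }
    where
      edge : ∀ v d → Present v d → Σ (V G) λ u → Adj G v u × (c v u ≡ col v d)
      edge v d p with neighbour v d p
      ... | u , nb = u , nb-adj v d u nb , c-col v d u nb

      in-range : ∀ v u → Adj G v u → (1 ≤ c v u) × (c v u ≤ t)
      in-range v u a with classify v u a
      ... | d , nb rewrite c-col v d u nb = proj₁ (local v) d (nb-present v d u nb)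

      distinct : ∀ v u w → Adj G v u → Adj G v w → c v u ≡ c v w → u ≡ w
      distinct v u w au aw e with classify v u au | classify v w aw
      ... | d , nbu | d' , nbw with proj₁ (proj₂ (local v)) d d' (nb-present v d u nbu) (nb-present v d' w nbw)
                                     (trans (sym (c-col v d u nbu)) (trans e (c-col v d' w nbw)))
      ...   | refl = nb-unique v d u w nbu nbw

      interval : ∀ v u w q → Adj G v u → Adj G v w → c v u ≤ q → q ≤ c v w →
                 ∃[ x ] (Adj G v x × (c v x ≡ q))
      interval v u w q au aw u≤q q≤w with classify v u au | classify v w aw
      ... | d , nbu | d' , nbw
        with proj₂ (proj₂ (local v)) d d' (nb-present v d u nbu) (nb-present v d' w nbw) (fromℕ< q<1+t)
               (subst₂ _≤_ (c-col v d u nbu) (sym q-index) u≤q)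
               (subst₂ _≤_ (sym q-index) (c-col v d' w nbw) q≤w)
        where
          q<1+t : q < suc t
          q<1+t = s≤s (≤-trans q≤w (proj₂ (in-range v w aw)))
          q-index : toℕ (fromℕ< q<1+t) ≡ q
          q-index = FinP.toℕ-fromℕ< q<1+t
      ... | d'' , p , col≡q with edge v d'' p
      ...   | x , ax , c≡col = x , ax , trans c≡col (trans col≡q (FinP.toℕ-fromℕ< _))

      all-used : ∀ q → 1 ≤ q → q ≤ t → ∃[ u ] ∃[ v ] (Adj G u v × (c u v ≡ q))
      all-used q 1≤q q≤t with used q 1≤q q≤t
      ... | v , d , p , col≡q with edge v d p
      ...   | u , a , c≡col = v , u , a , trans c≡col col≡q

module OddCylinder (m n : ℕ) (3≤m : 3 ≤ m) (1≤n : 1 ≤ n) where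

  k : ℕ
  k = suc (2 * n)

  3≤k : 3 ≤ k
  3≤k = s≤s (*-monoʳ-≤ 2 1≤n)

  open CylinderGeometry m k (≤-trans (n≤1+n 2) 3≤m) 3≤k public

  colClass-last : ∀ b → suc b ≡ k → colClass b ≡ last
  colClass-last zero    e = ⊥-elim (1≢k e)
  colClass-last (suc b) e with suc (suc b) ≟ k
  ... | yes _ = refl
  ... | no  b+2≢k = ⊥-elim (b+2≢k e)

  colClass-inner : ∀ b → suc (suc b) ≢ k → colClass (suc b) ≡ inner (isEven (suc b))
  colClass-inner b b+2≢k with suc (suc b) ≟ k
  ... | yes e = ⊥-elim (b+2≢k e)
  ... | no _  = refl

  -- The edge to the right of a column b < k-1 is the step edge of b's parity,
  -- and so is the edge to the left of column b+1; for the last column k-1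
  -- this uses that k is odd.
  rightEdge-colClass : ∀ b → suc b < k → rightEdge (colClass b) ≡ step (isEven b)
  rightEdge-colClass zero    _     = refl
  rightEdge-colClass (suc b) b+2<k rewrite colClass-inner b (<⇒≢ b+2<k) = refl

  leftEdge-colClass : ∀ b → leftEdge (colClass (suc b)) ≡ step (isEven b)
  leftEdge-colClass b with suc (suc b) ≟ k
  ... | yes b+2≡k = cong step (sym (begin
    isEven b              ≡⟨ isEven-pred b ⟩
    not (isEven (suc b))  ≡⟨ cong (λ x → not (isEven x)) (suc-injective b+2≡k) ⟩
    not (isEven (2 * n))  ≡⟨ cong not (isEven-double n) ⟩
    false                 ∎))
    where open ≡-Reasoning
  ... | no _ = cong step (sym (isEven-pred b))

  edge-types-agree : ∀ b' b → b' < k → suc b' % k ≡ b → rightEdge (colClass b') ≡ leftEdge (colClass b)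
  edge-types-agree b' b b'<k e with succ-mod b' b'<k
  ... | inj₂ (b'+1≡k , wraps) rewrite colClass-last b' b'+1≡k | trans (sym e) wraps = refl
  ... | inj₁ (b'+1<k , steps) with trans (sym steps) e
  ...   | refl = trans (rightEdge-colClass b' b'+1<k) (sym (leftEdge-colClass b'))

  rowPar-rowClass : ∀ a → rowPar (rowClass a) ≡ isEven a
  rowPar-rowClass zero = refl
  rowPar-rowClass (suc a) with suc (suc a) <? m
  ... | yes _ = refl
  ... | no  _ = refl

  abovePar-rowClass : ∀ a → abovePar (rowClass (suc a)) ≡ isEven a
  abovePar-rowClass a with suc (suc a) <? m
  ... | yes _ = sym (isEven-pred a)
  ... | no  _ = sym (isEven-pred a)

  spanColour : Pattern → ℕ → ℕ → ℕ → ℕ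
  spanColour P lo blo bhi with blo ≟ bhi
  ... | yes _ = vertical P (isEven lo) (colClass blo)
  ... | no _ with suc blo ≟ bhi
  ...   | yes _ = horizontal P (rowClass lo) (step (isEven blo))
  ...   | no _  = horizontal P (rowClass lo) seam

  span-vertical : ∀ P lo b → spanColour P lo b b ≡ vertical P (isEven lo) (colClass b)
  span-vertical P lo b with b ≟ b
  ... | yes _ = refl
  ... | no b≢b = ⊥-elim (b≢b refl)

  span-step : ∀ P lo b → spanColour P lo b (suc b) ≡ horizontal P (rowClass lo) (step (isEven b))
  span-step P lo b with b ≟ suc b
  ... | yes e = ⊥-elim (1+n≢n (sym e))
  ... | no _ with suc b ≟ suc b
  ...   | yes _ = refl
  ...   | no b+1≢b+1 = ⊥-elim (b+1≢b+1 refl)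

  span-seam : ∀ P lo b → 0 ≢ b → 1 ≢ b → spanColour P lo 0 b ≡ horizontal P (rowClass lo) seam
  span-seam P lo b 0≢b 1≢b with 0 ≟ b
  ... | yes e = ⊥-elim (0≢b e)
  ... | no _ with 1 ≟ b
  ...   | yes e = ⊥-elim (1≢b e)
  ...   | no _  = refl

  -- the edge colouring of a pattern; symmetric, as it only uses minima and maxima
  patternColouring : Pattern → V G → V G → ℕ
  patternColouring P (i , j) (i' , j') = spanColour P (toℕ i ⊓ toℕ i') (toℕ j ⊓ toℕ j') (toℕ j ⊔ toℕ j')

  patternColouring-sym : ∀ P u v → patternColouring P u v ≡ patternColouring P v u
  patternColouring-sym P (i , j) (i' , j')
    rewrite ⊓-comm (toℕ i) (toℕ i') | ⊓-comm (toℕ j) (toℕ j') | ⊔-comm (toℕ j) (toℕ j') = refl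

  vertexColour : Pattern → V G → Dir → ℕ
  vertexColour P (i , j) = dirColour P (rowClass (toℕ i)) (colClass (toℕ j))

  colour-down : ∀ P a b → spanColour P (a ⊓ suc a) (b ⊓ b) (b ⊔ b) ≡ dirColour P (rowClass a) (colClass b) down
  colour-down P a b rewrite m≤n⇒m⊓n≡m (n≤1+n a) | ⊓-idem b | ⊔-idem b | rowPar-rowClass a = span-vertical P a b

  colour-up : ∀ P a b → spanColour P (suc a ⊓ a) (b ⊓ b) (b ⊔ b) ≡ dirColour P (rowClass (suc a)) (colClass b) up
  colour-up P a b rewrite m≥n⇒m⊓n≡n (n≤1+n a) | ⊓-idem b | ⊔-idem b | abovePar-rowClass a = span-vertical P a b

  colour-right : ∀ P a b → b < k →
    spanColour P (a ⊓ a) (b ⊓ (suc b % k)) (b ⊔ (suc b % k)) ≡ dirColour P (rowClass a) (colClass b) right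
  colour-right P a b b<k rewrite ⊓-idem a with succ-mod b b<k
  ... | inj₁ (b+1<k , e) rewrite e | m≤n⇒m⊓n≡m (n≤1+n b) | m≤n⇒m⊔n≡n (n≤1+n b) | rightEdge-colClass b b+1<k =
    span-step P a b
  ... | inj₂ (b+1≡k , e) rewrite e | ⊓-zeroʳ b | ⊔-identityʳ b | colClass-last b b+1≡k =
    span-seam P a b (λ b≡0 → 1≢k (trans (cong suc b≡0) b+1≡k)) (λ b≡1 → 2≢k (trans (cong suc b≡1) b+1≡k))

  colour-dir : ∀ P v d u → Nb v d u → patternColouring P v u ≡ vertexColour P v d
  colour-dir P (i , j) down (i' , .j) (refl , x) with toℕ i' | x
  ... | .(suc (toℕ i)) | refl = colour-down P (toℕ i) (toℕ j)
  colour-dir P (i , j) up (i' , .j) (refl , x) with toℕ i | x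
  ... | .(suc (toℕ i')) | refl = colour-up P (toℕ i') (toℕ j)
  colour-dir P (i , j) right (.i , j') (refl , x) with toℕ j' | x
  ... | .(suc (toℕ j) % k) | refl = colour-right P (toℕ i) (toℕ j) (FinP.toℕ<n j)
  colour-dir P (i , j) left (.i , j') (refl , x) = begin
    patternColouring P (i , j) (i , j')          ≡⟨ patternColouring-sym P (i , j) (i , j') ⟩
    patternColouring P (i , j') (i , j)          ≡⟨ colour-dir P (i , j') right (i , j) (refl , x) ⟩
    horizontal P r (rightEdge (colClass (toℕ j'))) ≡⟨ cong (horizontal P r) (edge-types-agree _ _ (FinP.toℕ<n j') x) ⟩
    horizontal P r (leftEdge (colClass (toℕ j)))  ∎
    where
      open ≡-Reasoning
      r : RowClass
      r = rowClass (toℕ i)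

  rowClass-occurs : ∀ a → a < m → Occurs (isEven (m ∸ 1)) (rowClass a)
  rowClass-occurs zero    _ = tt
  rowClass-occurs (suc a) a+1<m with suc (suc a) <? m
  ... | yes _     = tt
  ... | no a+2≮m rewrite sym (≤-antisym a+1<m (≮⇒≥ a+2≮m)) = refl

  0<m : 0 < m
  0<m = ≤-trans (s≤s z≤n) 3≤m

  1<m : 1 < m
  1<m = ≤-trans (s≤s (s≤s z≤n)) 3≤m

  0<k : 0 < k
  0<k = s≤s z≤n

  1<k : 1 < k
  1<k = ≤-trans (s≤s (s≤s z≤n)) 3≤k

  2n<k : 2 * n < k
  2n<k = n<1+n (2 * n)

  sampleVertex : Sample → V G
  sampleVertex at00    = fromℕ< 0<m , fromℕ< 0<k
  sampleVertex at10    = fromℕ< 1<m , fromℕ< 0<k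
  sampleVertex at11    = fromℕ< 1<m , fromℕ< 1<k
  sampleVertex at1last = fromℕ< 1<m , fromℕ< 2n<k

  rowClass-1 : rowClass 1 ≡ interior false
  rowClass-1 with 2 <? m
  ... | yes _   = refl
  ... | no 2≮m = ⊥-elim (2≮m 3≤m)

  colClass-1 : colClass 1 ≡ inner false
  colClass-1 with 2 ≟ k
  ... | yes 2≡k = ⊥-elim (2≢k 2≡k)
  ... | no _    = refl

  sampleVertex-class : ∀ s → let (i , j) = sampleVertex s in
                       (rowClass (toℕ i) ≡ sampleRow s) × (colClass (toℕ j) ≡ sampleCol s)
  sampleVertex-class at00    = cong rowClass (FinP.toℕ-fromℕ< 0<m) , cong colClass (FinP.toℕ-fromℕ< 0<k)
  sampleVertex-class at10    = trans (cong rowClass (FinP.toℕ-fromℕ< 1<m)) rowClass-1 ,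
                               cong colClass (FinP.toℕ-fromℕ< 0<k)
  sampleVertex-class at11    = trans (cong rowClass (FinP.toℕ-fromℕ< 1<m)) rowClass-1 ,
                               trans (cong colClass (FinP.toℕ-fromℕ< 1<k)) colClass-1
  sampleVertex-class at1last = trans (cong rowClass (FinP.toℕ-fromℕ< 1<m)) rowClass-1 ,
                               trans (cong colClass (FinP.toℕ-fromℕ< 2n<k)) (colClass-last (2 * n) refl)

  pattern-interval : ∀ P t → Valid P t (isEven (m ∸ 1)) → Uses P t → IsIntervalColoring G t (patternColouring P)
  pattern-interval P t valid uses =
    local-to-global (patternColouring P) (vertexColour P) (patternColouring-sym P) (colour-dir P) local used
    where
      local : ∀ v → Local t (presentAt v) (vertexColour P v)
      local (i , j) = valid (rowClass (toℕ i)) (colClass (toℕ j)) (rowClass-occurs (toℕ i) (FinP.toℕ<n i))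
      used : ∀ q → 1 ≤ q → q ≤ t → Σ (V G) λ v → Σ Dir λ d → Present v d × (vertexColour P v d ≡ q)
      used q 1≤q q≤t with uses q 1≤q q≤t
      ... | s , d , p , colour≡q with sampleVertex-class s
      ...   | row≡ , col≡ = sampleVertex s , d , subst (λ r → T (present r d)) (sym row≡) p ,
                              trans (cong₂ (λ r c → dirColour P r c d) row≡ col≡) colour≡q

  star-at10 : Star G (sampleVertex at10) 4
  star-at10 = star4 (sampleVertex at10)
                (λ d → subst (λ r → T (present r d)) (sym (proj₁ (sampleVertex-class at10))) (interior-all d))
    where
      interior-all : ∀ d → T (present (interior false) d)
      interior-all up    = tt
      interior-all down  = tt
      interior-all left  = tt
      interior-all right = tt

  bottom-parity : isEven (m ∸ 1) ≡ not (isEven m)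
  bottom-parity = isEven-∸1 m (≤-trans (s≤s z≤n) 3≤m)

  even-colouring : m % 2 ≡ 0 → HasIntervalColoring G 4
  even-colouring m-even = patternColouring evenPattern ,
    pattern-interval evenPattern 4 (subst (Valid evenPattern 4) bottom-odd evenPattern-valid) evenPattern-uses
    where
      bottom-odd : false ≡ isEven (m ∸ 1)
      bottom-odd = sym (trans bottom-parity (cong not (isEven-even m m-even)))

  odd-colouring : m % 2 ≡ 1 → HasIntervalColoring G 6
  odd-colouring m-odd = patternColouring oddPattern ,
    pattern-interval oddPattern 6 (subst (Valid oddPattern 6) bottom-even oddPattern-valid) oddPattern-uses
    where
      bottom-even : true ≡ isEven (m ∸ 1)
      bottom-even = sym (trans bottom-parity (cong not (isEven-odd m m-odd)))

  at-least-4 : ∀ t → HasIntervalColoring G t → 4 ≤ t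
  at-least-4 t (c , ic) = IntervalColouringFacts.star≤colours ic star-at10

  at-least-6 : m % 2 ≡ 1 → ∀ t → HasIntervalColoring G t → 6 ≤ t
  at-least-6 m-odd t (c , ic) =
    odd-order⇒six-colours adj-sym adj-irr star3 (m * k) FinP.*↔× (λ h → odd*odd≢double m k h m-odd k-odd) ic
    where
      k-odd : k % 2 ≡ 1
      k-odd = trans (cong (λ x → suc x % 2) (*-comm 2 n)) ([m+kn]%n≡m%n 1 n 2)

theorem16 : ∀ (m n : ℕ) → 3 ≤ m → 1 ≤ n →
    IntervalColorable (Cyl m (suc (2 * n)))
    × (m % 2 ≡ 0 → IsW (Cyl m (suc (2 * n))) 4)
    × (m % 2 ≡ 1 → IsW (Cyl m (suc (2 * n))) 6)
theorem16 m n 3≤m 1≤n = colourable , even-case , odd-case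
  where
    open OddCylinder m n 3≤m 1≤n

    even-case : m % 2 ≡ 0 → IsW G 4
    even-case m-even = even-colouring m-even , at-least-4

    odd-case : m % 2 ≡ 1 → IsW G 6
    odd-case m-odd = odd-colouring m-odd , at-least-6 m-odd

    colourable : IntervalColorable G
    colourable with %2-cases m
    ... | inj₁ m-even = 4 , s≤s z≤n , even-colouring m-even
    ... | inj₂ m-odd  = 6 , s≤s z≤n , odd-colouring m-odd
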